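{- Let $0<m<n$, $J\subsetneq\mathbb Z/n\mathbb Z$ and $i\in J$. Then $A_{d_J}A_i$, $A_iA_{d_J}$, $A_{u_J}A_i$ and $A_iA_{u_J}$ are all zero in $\mathbb A_{m,n}$.
   Context: $\widetilde S_n$ is the affine symmetric group with generators $s_i$, $i\in\mathbb Z/n\mathbb Z$. For $J\subsetneq\mathbb Z/n\mathbb Z$, $d_J$ (resp. $u_J$) is the element which is the product of the $s_j$, $j\in J$, each exactly once, with $s_{j+1}$ to the left of $s_j$ (resp. $s_j$ to the left of $s_{j+1}$) whenever $j,j+1\in J$; these are the cyclically decreasing (resp. increasing) elements. The affine nilCoxeter algebra $\mathbb A$ is the $\mathbb Z$-algebra generated by $A_i$ ($i\in\mathbb Z/n\mathbb Z$) with $A_i^2=0$, $A_iA_{i+1}A_i=A_{i+1}A_iA_{i+1}$, $A_iA_j=A_jA_i$ for $i-j\ne\pm1$; $A_w=A_{i_1}\cdots A_{i_l}$ for any reduced word $s_{i_1}\cdots s_{i_l}$ of $w$. $\mathbb A_{m,n}$ is the quotient of $\mathbb A$ by the two-sided ideal generated by all $A_iA_{i+1}A_i$, all $A_w$ with $w$ cyclically decreasing of length $>n-m$, and all $A_w$ with $w$ cyclically increasing of length $>m$; images are denoted by the same symbols. -}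

module Defs where

open import Data.Nat using (ℕ; zero; suc; _∸_; _<_; _%_)
open import Data.Nat.DivMod using (m%n<n)
open import Data.Fin using (Fin; toℕ; fromℕ<)
open import Data.Fin.Subset using (Subset; ⊤; _⊂_) renaming (_∈_ to _∈ₛ_)
open import Data.List using (List; []; _∷_; _++_; length; foldr)
open import Data.List.Membership.Propositional using (_∈_)
open import Data.List.Relation.Unary.Unique.Propositional using (Unique)
open import Data.Product using (_×_; ∃₂)
open import Relation.Binary.PropositionalEquality using (_≡_; _≢_)

-- Z/nZ is modelled by Fin n; cyclic successor j ↦ j+1 (mod n).
next : ∀ {n} → Fin n → Fin n
next {suc n} i = fromℕ< (m%n<n (suc (toℕ i)) (suc n))

Before : ∀ {n} → Fin n → Fin n → List (Fin n) → Set
Before a b w = ∃₂ λ xs ys → (w ≡ xs ++ (a ∷ ys)) × (b ∈ ys)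

Lists : ∀ {n} → Subset n → List (Fin n) → Set
Lists J w = Unique w × (∀ j → j ∈ w → j ∈ₛ J) × (∀ j → j ∈ₛ J → j ∈ w)

-- w is a word for d_J: s_{j+1} to the left of s_j whenever j, j+1 ∈ J
IsDecWord : ∀ {n} → Subset n → List (Fin n) → Set
IsDecWord J w = Lists J w × (∀ j → j ∈ₛ J → next j ∈ₛ J → Before (next j) j w)

-- w is a word for u_J: s_j to the left of s_{j+1} whenever j, j+1 ∈ J
IsIncWord : ∀ {n} → Subset n → List (Fin n) → Set
IsIncWord J w = Lists J w × (∀ j → j ∈ₛ J → next j ∈ₛ J → Before j (next j) w)

-- Terms of the free (unital, associative) ring Z⟨A_0,…,A_{n-1}⟩
infixl 6 _⊕_
infixl 7 _⊗_
data Term (n : ℕ) : Set where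
  0# 1#   : Term n
  A       : Fin n → Term n
  _⊕_ _⊗_ : Term n → Term n → Term n
  ⊖_      : Term n → Term n

mono : ∀ {n} → List (Fin n) → Term n
mono = foldr (λ i t → A i ⊗ t) 1#

-- Defining relations of A_{m,n}: those of the affine nilCoxeter algebra,
-- plus A_i A_{i+1} A_i = 0, A_{d_J} = 0 for |J| > n - m, A_{u_J} = 0 for |J| > m.
data Rel (m n : ℕ) : Term n → Term n → Set where
  nil   : ∀ i → Rel m n (A i ⊗ A i) 0#
  braid : ∀ i → Rel m n (A i ⊗ A (next i) ⊗ A i) (A (next i) ⊗ A i ⊗ A (next i))
  comm  : ∀ i j → j ≢ next i → i ≢ next j → Rel m n (A i ⊗ A j) (A j ⊗ A i)
  cube  : ∀ i → Rel m n (A i ⊗ A (next i) ⊗ A i) 0#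
  dec   : ∀ (J : Subset n) w → J ⊂ ⊤ → IsDecWord J w → n ∸ m < length w → Rel m n (mono w) 0#
  inc   : ∀ (J : Subset n) w → J ⊂ ⊤ → IsIncWord J w → m < length w → Rel m n (mono w) 0#

-- Equality in A_{m,n} = Z⟨A_i⟩ / (two-sided ideal generated by Rel):
-- the least congruence containing the ring axioms and Rel.
infix 4 _≈⟨_,_⟩_
data _≈⟨_,_⟩_ {n : ℕ} : Term n → ℕ → ℕ → Term n → Set where
  rel    : ∀ {m x y} → Rel m n x y → x ≈⟨ m , n ⟩ y
  refl   : ∀ {m x} → x ≈⟨ m , n ⟩ x
  sym    : ∀ {m x y} → x ≈⟨ m , n ⟩ y → y ≈⟨ m , n ⟩ x
  trans  : ∀ {m x y z} → x ≈⟨ m , n ⟩ y → y ≈⟨ m , n ⟩ z → x ≈⟨ m , n ⟩ z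
  ⊕-cong : ∀ {m x x′ y y′} → x ≈⟨ m , n ⟩ x′ → y ≈⟨ m , n ⟩ y′ → x ⊕ y ≈⟨ m , n ⟩ x′ ⊕ y′
  ⊗-cong : ∀ {m x x′ y y′} → x ≈⟨ m , n ⟩ x′ → y ≈⟨ m , n ⟩ y′ → x ⊗ y ≈⟨ m , n ⟩ x′ ⊗ y′
  ⊖-cong : ∀ {m x x′} → x ≈⟨ m , n ⟩ x′ → ⊖ x ≈⟨ m , n ⟩ ⊖ x′
  ⊕-assoc : ∀ {m x y z} → (x ⊕ y) ⊕ z ≈⟨ m , n ⟩ x ⊕ (y ⊕ z)
  ⊕-comm  : ∀ {m x y} → x ⊕ y ≈⟨ m , n ⟩ y ⊕ x
  ⊕-idˡ   : ∀ {m x} → 0# ⊕ x ≈⟨ m , n ⟩ x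
  ⊖-invˡ  : ∀ {m x} → (⊖ x) ⊕ x ≈⟨ m , n ⟩ 0#
  ⊗-assoc : ∀ {m x y z} → (x ⊗ y) ⊗ z ≈⟨ m , n ⟩ x ⊗ (y ⊗ z)
  ⊗-idˡ   : ∀ {m x} → 1# ⊗ x ≈⟨ m , n ⟩ x
  ⊗-idʳ   : ∀ {m x} → x ⊗ 1# ≈⟨ m , n ⟩ x
  distribˡ : ∀ {m x y z} → x ⊗ (y ⊕ z) ≈⟨ m , n ⟩ (x ⊗ y) ⊕ (x ⊗ z)
  distribʳ : ∀ {m x y z} → (y ⊕ z) ⊗ x ≈⟨ m , n ⟩ (y ⊗ x) ⊕ (z ⊗ x)

module Submission where

open import Defs
open import Data.Nat using (ℕ; _<_)
open import Data.Fin using (Fin)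
open import Data.Fin.Subset using (Subset; ⊤; _⊂_; _∈_)
open import Data.List using (List)
open import Data.Product using (_×_)

open import Data.Nat as ℕ using (suc; _%_)
open import Data.Nat.Properties as ℕ using ()
open import Data.Nat.DivMod using (m≤n⇒m%n≡m; n%n≡0)
open import Data.Fin using (toℕ)
open import Data.Fin.Properties using (_≟_; toℕ-fromℕ<; toℕ-injective; toℕ<n)
open import Data.List using ([]; _∷_; _++_; [_])
open import Data.List.Properties using (++-assoc; ∷-injective)
open import Data.List.Membership.Propositional using () renaming (_∈_ to _∈ₗ_)
open import Data.List.Membership.Propositional.Properties using (∈-++⁺ˡ; ∈-++⁺ʳ; ∈-∃++)
open import Data.List.Relation.Unary.Any using (here; there)
open import Data.List.Relation.Unary.All as All using (All; []; _∷_)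
open import Data.List.Relation.Unary.All.Properties as All using ()
open import Data.List.Relation.Unary.AllPairs using ([]; _∷_)
open import Data.List.Relation.Unary.Unique.Propositional using (Unique)
open import Data.Product using (_,_; proj₂)
open import Data.Sum using (_⊎_; inj₁; inj₂)
open import Data.Empty using (⊥; ⊥-elim)
open import Function using (_∘_)
open import Relation.Nullary using (¬_; Dec; yes; no)
open import Relation.Nullary.Decidable using (¬?; _×-dec_)
open import Relation.Binary.Bundles using (Setoid)
open import Relation.Binary.PropositionalEquality as ≡ using (_≡_; _≢_)

-- Write a reduced word w for d_J (or u_J) as  w = xs ++ i ∷ ys.
-- Right multiplication by A_i gives the monomial  xs · i · ys · i,  left
-- multiplication gives  i · xs · i · ys.  The letters of w are distinct and,
-- by the cyclic order defining d_J (resp. u_J), the segment between the two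
-- copies of i contains a neighbour i±1 of i on one side only; hence at most
-- one of its letters fails to commute with A_i.  Commuting A_i past the other
-- letters leaves a factor A_i A_i = 0 or A_i A_k A_i with k = i±1, and the
-- latter vanishes by the cube relation (directly, or after one braid move).

suc-mod : ∀ {k x} → x < suc k → (suc x % suc k ≡ suc x) ⊎ (x ≡ k × suc x % suc k ≡ 0)
suc-mod {k} {x} x<1+k with x ℕ.<? k
... | yes x<k = inj₁ (m≤n⇒m%n≡m x<k)
... | no x≮k = inj₂ (x≡k , ≡.subst (λ z → suc z % suc k ≡ 0) (≡.sym x≡k) (n%n≡0 (suc k)))
  where
  x≡k : x ≡ k
  x≡k = ℕ.≤-antisym (ℕ.s≤s⁻¹ x<1+k) (ℕ.≮⇒≥ x≮k)

next-injective : ∀ {n} {a b : Fin n} → next a ≡ next b → a ≡ b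
next-injective {suc k} {a} {b} eq =
  toℕ-injective (compare (suc-mod (toℕ<n a)) (suc-mod (toℕ<n b)))
  where
  eq′ : suc (toℕ a) % suc k ≡ suc (toℕ b) % suc k
  eq′ = ≡.trans (≡.sym (toℕ-fromℕ< _)) (≡.trans (≡.cong toℕ eq) (toℕ-fromℕ< _))

  compare : _ → _ → toℕ a ≡ toℕ b
  compare (inj₁ a′) (inj₁ b′) = ℕ.suc-injective (≡.trans (≡.sym a′) (≡.trans eq′ b′))
  compare (inj₂ (a≡k , _)) (inj₂ (b≡k , _)) = ≡.trans a≡k (≡.sym b≡k)
  compare (inj₁ a′) (inj₂ (_ , b′)) with ≡.trans (≡.sym a′) (≡.trans eq′ b′)
  ... | ()
  compare (inj₂ (_ , a′)) (inj₁ b′) with ≡.trans (≡.sym b′) (≡.trans (≡.sym eq′) a′)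
  ... | ()

module _ {ℓ} {X : Set ℓ} where

  Unique-++⁻ˡ : ∀ (xs : List X) {ys} → Unique (xs ++ ys) → Unique xs
  Unique-++⁻ˡ []       _         = []
  Unique-++⁻ˡ (x ∷ xs) (x∉ ∷ u) = All.++⁻ˡ xs x∉ ∷ Unique-++⁻ˡ xs u

  Unique-++⁻ʳ : ∀ (xs : List X) {ys} → Unique (xs ++ ys) → Unique ys
  Unique-++⁻ʳ []       u       = u
  Unique-++⁻ʳ (_ ∷ xs) (_ ∷ u) = Unique-++⁻ʳ xs u

module _ {n : ℕ} where

  Before-suffix : ∀ {a b : Fin n} xs {ys} → b ∈ₗ ys → Before a b (xs ++ a ∷ ys)
  Before-suffix xs b∈ys = xs , _ , ≡.refl , b∈ys

  Before-prefix : ∀ {a b : Fin n} {xs} ys → b ∈ₗ xs → Before b a (xs ++ a ∷ ys)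
  Before-prefix {a} {b} ys b∈xs with ∈-∃++ b∈xs
  ... | p , r , ≡.refl = p , r ++ a ∷ ys , ++-assoc p (b ∷ r) (a ∷ ys) , ∈-++⁺ʳ r (here ≡.refl)

  private
    crossed : ∀ {a b : Fin n} xs ys as bs → Unique (xs ++ a ∷ ys) → b ∈ₗ ys →
              xs ++ a ∷ ys ≡ as ++ b ∷ bs → a ∈ₗ bs → ⊥
    crossed [] ys [] bs (a∉ys ∷ _) _ eq a∈bs with ∷-injective eq
    ... | ≡.refl , ≡.refl = All.lookup a∉ys a∈bs ≡.refl
    crossed [] ys (_ ∷ as) bs (a∉ys ∷ _) _ eq a∈bs with ∷-injective eq
    ... | ≡.refl , ≡.refl = All.lookup a∉ys (∈-++⁺ʳ as (there a∈bs)) ≡.refl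
    crossed (_ ∷ xs) ys [] bs (b∉ ∷ _) b∈ys eq _ with ∷-injective eq
    ... | ≡.refl , _ = All.lookup b∉ (∈-++⁺ʳ xs (there b∈ys)) ≡.refl
    crossed (_ ∷ xs) ys (_ ∷ as) bs (_ ∷ u) b∈ys eq a∈bs =
      crossed xs ys as bs u b∈ys (proj₂ (∷-injective eq)) a∈bs

  Before-asym : ∀ {a b : Fin n} {w} → Unique w → Before a b w → Before b a w → ⊥
  Before-asym u (xs , ys , ≡.refl , b∈ys) (as , bs , eq , a∈bs) = crossed xs ys as bs u b∈ys eq a∈bs

module _ {n : ℕ} where

  Commutes : Fin n → Fin n → Set
  Commutes i j = (j ≢ next i) × (i ≢ next j)

  commutes? : ∀ i j → Dec (Commutes i j)
  commutes? i j = ¬? (j ≟ next i) ×-dec ¬? (i ≟ next j)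

  adjacent : ∀ {i j} → ¬ Commutes i j → j ≡ next i ⊎ i ≡ next j
  adjacent {i} {j} ¬c with j ≟ next i | i ≟ next j
  ... | yes j≡i+1 | _         = inj₁ j≡i+1
  ... | no _      | yes i≡j+1 = inj₂ i≡j+1
  ... | no j≢i+1  | no i≢j+1  = ⊥-elim (¬c (j≢i+1 , i≢j+1))

  data NearlyCommuting (i : Fin n) : List (Fin n) → Set where
    all   : ∀ {ws} → All (Commutes i) ws → NearlyCommuting i ws
    one   : ∀ ws₁ k ws₂ → All (Commutes i) ws₁ → ¬ Commutes i k → All (Commutes i) ws₂ →
            NearlyCommuting i (ws₁ ++ k ∷ ws₂)

  nearly-∷ : ∀ {i j ws} → Commutes i j → NearlyCommuting i ws → NearlyCommuting i (j ∷ ws)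
  nearly-∷ c (all cs)                = all (c ∷ cs)
  nearly-∷ c (one ws₁ k ws₂ cs₁ ¬c cs₂) = one (_ ∷ ws₁) k ws₂ (c ∷ cs₁) ¬c cs₂

  nearly-by-uniqueness : ∀ {i} (P : Fin n → Set) → (∀ {j k} → P j → P k → j ≡ k) →
    ∀ {ws} → Unique ws → (∀ {j} → j ∈ₗ ws → ¬ Commutes i j → P j) → NearlyCommuting i ws
  nearly-by-uniqueness P P-unique {[]} _ _ = all []
  nearly-by-uniqueness {i} P P-unique {j ∷ ws} (j∉ws ∷ u) blocked with commutes? i j
  ... | yes c = nearly-∷ c (nearly-by-uniqueness P P-unique u (blocked ∘ there))
  ... | no ¬c = one [] j ws [] ¬c (All.tabulate rest)
    where
    rest : ∀ {j′} → j′ ∈ₗ ws → Commutes i j′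
    rest {j′} j′∈ws with commutes? i j′
    ... | yes c′  = c′
    ... | no ¬c′ = ⊥-elim (All.lookup j∉ws j′∈ws
                     (P-unique (blocked (here ≡.refl) ¬c) (blocked (there j′∈ws) ¬c′)))

  OneSided : Fin n → List (Fin n) → Set
  OneSided i ws = (∀ {j} → j ∈ₗ ws → j ≢ next i) ⊎ (∀ {j} → j ∈ₗ ws → i ≢ next j)

  -- Distinct letters avoiding one neighbour of i contain at most the other one.
  one-sided⇒nearly : ∀ {i ws} → Unique ws → OneSided i ws → NearlyCommuting i ws
  one-sided⇒nearly {i} {ws} u (inj₁ no-succ) = nearly-by-uniqueness (λ j → i ≡ next j)
    (λ i≡j+1 i≡k+1 → next-injective (≡.trans (≡.sym i≡j+1) i≡k+1)) u blocked
    where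
    blocked : ∀ {j} → j ∈ₗ ws → ¬ Commutes i j → i ≡ next j
    blocked j∈ws ¬c with adjacent ¬c
    ... | inj₁ j≡i+1 = ⊥-elim (no-succ j∈ws j≡i+1)
    ... | inj₂ i≡j+1 = i≡j+1
  one-sided⇒nearly {i} {ws} u (inj₂ no-pred) = nearly-by-uniqueness (λ j → j ≡ next i)
    (λ j≡i+1 k≡i+1 → ≡.trans j≡i+1 (≡.sym k≡i+1)) u blocked
    where
    blocked : ∀ {j} → j ∈ₗ ws → ¬ Commutes i j → j ≡ next i
    blocked j∈ws ¬c with adjacent ¬c
    ... | inj₁ j≡i+1 = j≡i+1
    ... | inj₂ i≡j+1 = ⊥-elim (no-pred j∈ws i≡j+1)

-- Take a word  xs ++ i ∷ ys  for d_J or u_J, with i ∈ J.  Whenever a neighbour of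
-- i occurs in it, the defining order constraint fixes on which side of i it sits.
module _ {n : ℕ} {J : Subset n} {i : Fin n} (xs : List (Fin n)) {ys : List (Fin n)} where

  -- d_J: i+1 is left of i, and i is left of i-1.
  dec-after : IsDecWord J (xs ++ i ∷ ys) → i ∈ J → ∀ {j} → j ∈ₗ ys → j ≢ next i
  dec-after ((u , letters , _) , before) i∈J j∈ys ≡.refl =
    Before-asym u (before i i∈J (letters _ (∈-++⁺ʳ xs (there j∈ys)))) (Before-suffix xs j∈ys)

  dec-before : IsDecWord J (xs ++ i ∷ ys) → i ∈ J → ∀ {j} → j ∈ₗ xs → i ≢ next j
  dec-before ((u , letters , _) , before) i∈J {j} j∈xs i≡j+1 =
    Before-asym u (≡.subst (λ k → Before k j _) (≡.sym i≡j+1)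
                    (before j (letters j (∈-++⁺ˡ j∈xs)) (≡.subst (_∈ J) i≡j+1 i∈J)))
                  (Before-prefix ys j∈xs)

  -- u_J: i is left of i+1, and i-1 is left of i.
  inc-after : IsIncWord J (xs ++ i ∷ ys) → i ∈ J → ∀ {j} → j ∈ₗ ys → i ≢ next j
  inc-after ((u , letters , _) , before) i∈J {j} j∈ys i≡j+1 =
    Before-asym u (≡.subst (λ k → Before j k _) (≡.sym i≡j+1)
                    (before j (letters j (∈-++⁺ʳ xs (there j∈ys))) (≡.subst (_∈ J) i≡j+1 i∈J)))
                  (Before-suffix xs j∈ys)

  inc-before : IsIncWord J (xs ++ i ∷ ys) → i ∈ J → ∀ {j} → j ∈ₗ xs → j ≢ next i
  inc-before ((u , letters , _) , before) i∈J j∈xs ≡.refl =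
    Before-asym u (before i i∈J (letters _ (∈-++⁺ˡ j∈xs))) (Before-prefix ys j∈xs)

module InA (m n : ℕ) where

  infix 4 _≈_
  _≈_ : Term n → Term n → Set
  x ≈ y = x ≈⟨ m , n ⟩ y

  ≈-setoid : Setoid _ _
  ≈-setoid = record
    { Carrier       = Term n
    ; _≈_           = _≈_
    ; isEquivalence = record { refl = refl ; sym = sym ; trans = trans }
    }

  open import Relation.Binary.Reasoning.Setoid ≈-setoid

  idempotent⇒zero : ∀ {y} → y ≈ y ⊕ y → y ≈ 0#
  idempotent⇒zero {y} y≈y+y = begin
    y                  ≈⟨ sym ⊕-idˡ ⟩
    0# ⊕ y             ≈⟨ ⊕-cong (sym ⊖-invˡ) refl ⟩
    (⊖ y ⊕ y) ⊕ y      ≈⟨ ⊕-assoc ⟩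
    ⊖ y ⊕ (y ⊕ y)      ≈⟨ ⊕-cong refl (sym y≈y+y) ⟩
    ⊖ y ⊕ y            ≈⟨ ⊖-invˡ ⟩
    0#                 ∎

  zeroʳ : ∀ {x} → x ⊗ 0# ≈ 0#
  zeroʳ = idempotent⇒zero (trans (⊗-cong refl (sym ⊕-idˡ)) distribˡ)

  zeroˡ : ∀ {x} → 0# ⊗ x ≈ 0#
  zeroˡ = idempotent⇒zero (trans (⊗-cong (sym ⊕-idˡ) refl) distribʳ)

  mono-++ : ∀ p q → mono (p ++ q) ≈ mono p ⊗ mono q
  mono-++ []      q = sym ⊗-idˡ
  mono-++ (x ∷ p) q = trans (⊗-cong refl (mono-++ p q)) (sym ⊗-assoc)

  prefix-zero : ∀ p {q} → mono q ≈ 0# → mono (p ++ q) ≈ 0#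
  prefix-zero p {q} q≈0 = trans (mono-++ p q) (trans (⊗-cong refl q≈0) zeroʳ)

  prefix-cong : ∀ p {q r} → mono q ≈ mono r → mono (p ++ q) ≈ mono (p ++ r)
  prefix-cong p {q} {r} q≈r = trans (mono-++ p q) (trans (⊗-cong refl q≈r) (sym (mono-++ p r)))

  front₃ : ∀ {a b c t} → a ⊗ b ⊗ c ≈ 0# → a ⊗ (b ⊗ (c ⊗ t)) ≈ 0#
  front₃ {a} {b} {c} {t} abc≈0 = begin
    a ⊗ (b ⊗ (c ⊗ t))  ≈⟨ sym ⊗-assoc ⟩
    (a ⊗ b) ⊗ (c ⊗ t)  ≈⟨ sym ⊗-assoc ⟩
    (a ⊗ b ⊗ c) ⊗ t    ≈⟨ ⊗-cong abc≈0 refl ⟩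
    0# ⊗ t             ≈⟨ zeroˡ ⟩
    0#                 ∎

  -- A_i A_i = 0, and A_i A_k A_i = 0 for cyclically adjacent i, k: for k = i+1
  -- this is the cube relation, for i = k+1 it is the cube relation after a braid.
  square-zero : ∀ i q → mono (i ∷ i ∷ q) ≈ 0#
  square-zero i q = trans (sym ⊗-assoc) (trans (⊗-cong (rel (nil i)) refl) zeroˡ)

  sandwich-adjacent : ∀ i k q → ¬ Commutes i k → mono (i ∷ k ∷ i ∷ q) ≈ 0#
  sandwich-adjacent i k q ¬c with adjacent ¬c
  ... | inj₁ ≡.refl = front₃ (rel (cube i))
  ... | inj₂ ≡.refl = front₃ (trans (sym (rel (braid k))) (rel (cube k)))

  swap : ∀ {i j} q → Commutes i j → mono (i ∷ j ∷ q) ≈ mono (j ∷ i ∷ q)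
  swap {i} {j} q (j≢i+1 , i≢j+1) =
    trans (sym ⊗-assoc) (trans (⊗-cong (rel (comm i j j≢i+1 i≢j+1)) refl) ⊗-assoc)

  slide : ∀ {i ys} q → All (Commutes i) ys → mono (i ∷ ys ++ q) ≈ mono (ys ++ i ∷ q)
  slide q []                     = refl
  slide {ys = y ∷ ys} q (c ∷ cs) = trans (swap (ys ++ q) c) (⊗-cong refl (slide q cs))

  sandwich : ∀ {i ws} q → NearlyCommuting i ws → mono (i ∷ ws ++ i ∷ q) ≈ 0#
  sandwich {i} {ws} q (all cs) =
    trans (slide (i ∷ q) cs) (prefix-zero ws (square-zero i q))
  sandwich {i} q (one ws₁ k ws₂ cs₁ ¬c cs₂) =
    ≡.subst (λ w → mono (i ∷ w) ≈ 0#) (≡.sym (++-assoc ws₁ (k ∷ ws₂) (i ∷ q))) (begin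
      mono (i ∷ ws₁ ++ k ∷ ws₂ ++ i ∷ q)  ≈⟨ slide (k ∷ ws₂ ++ i ∷ q) cs₁ ⟩
      mono (ws₁ ++ i ∷ k ∷ ws₂ ++ i ∷ q)  ≈⟨ prefix-cong ws₁ (prefix-cong (i ∷ k ∷ []) {ws₂ ++ i ∷ q} {i ∷ ws₂ ++ q}
                                                (sym (slide q cs₂))) ⟩
      mono (ws₁ ++ i ∷ k ∷ i ∷ ws₂ ++ q)  ≈⟨ prefix-zero ws₁ (sandwich-adjacent i k (ws₂ ++ q) ¬c) ⟩
      0#                                  ∎)

  absorbʳ : ∀ {i} xs {ys} → Unique (xs ++ i ∷ ys) → OneSided i ys → mono (xs ++ i ∷ ys) ⊗ A i ≈ 0#
  absorbʳ {i} xs {ys} u one-sided = begin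
    mono (xs ++ i ∷ ys) ⊗ A i             ≈⟨ ⊗-cong refl (sym ⊗-idʳ) ⟩
    mono (xs ++ i ∷ ys) ⊗ mono [ i ]      ≈⟨ sym (mono-++ (xs ++ i ∷ ys) [ i ]) ⟩
    mono ((xs ++ i ∷ ys) ++ [ i ])        ≡⟨ ≡.cong mono (++-assoc xs (i ∷ ys) [ i ]) ⟩
    mono (xs ++ i ∷ ys ++ [ i ])          ≈⟨ prefix-zero xs (sandwich [] (one-sided⇒nearly u-ys one-sided)) ⟩
    0#                                    ∎
    where
    u-ys : Unique ys
    u-ys with Unique-++⁻ʳ xs u
    ... | _ ∷ u-ys = u-ys

  absorbˡ : ∀ {i} xs {ys} → Unique (xs ++ i ∷ ys) → OneSided i xs → A i ⊗ mono (xs ++ i ∷ ys) ≈ 0#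
  absorbˡ xs {ys} u one-sided = sandwich ys (one-sided⇒nearly (Unique-++⁻ˡ xs u) one-sided)

  decWord-absorbs : ∀ {J i d} → IsDecWord J d → i ∈ J → (mono d ⊗ A i ≈ 0#) × (A i ⊗ mono d ≈ 0#)
  decWord-absorbs d-word@((u , _ , complete) , _) i∈J with ∈-∃++ (complete _ i∈J)
  ... | xs , ys , ≡.refl =
    absorbʳ xs u (inj₁ (dec-after xs d-word i∈J)) , absorbˡ xs u (inj₂ (dec-before xs d-word i∈J))

  incWord-absorbs : ∀ {J i u} → IsIncWord J u → i ∈ J → (mono u ⊗ A i ≈ 0#) × (A i ⊗ mono u ≈ 0#)
  incWord-absorbs u-word@((u , _ , complete) , _) i∈J with ∈-∃++ (complete _ i∈J)
  ... | xs , ys , ≡.refl =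
    absorbʳ xs u (inj₂ (inc-after xs u-word i∈J)) , absorbˡ xs u (inj₁ (inc-before xs u-word i∈J))

lemma4 : (m n : ℕ) → 0 < m → m < n → (J : Subset n) → J ⊂ ⊤ → (i : Fin n) → i ∈ J →
    (d u : List (Fin n)) → IsDecWord J d → IsIncWord J u →
      (mono d ⊗ A i ≈⟨ m , n ⟩ 0#) × (A i ⊗ mono d ≈⟨ m , n ⟩ 0#)
      × (mono u ⊗ A i ≈⟨ m , n ⟩ 0#) × (A i ⊗ mono u ≈⟨ m , n ⟩ 0#)
lemma4 m n _ _ J _ i i∈J d u d-word u-word =
  let open InA m n
      (dA , Ad) = decWord-absorbs d-word i∈J
      (uA , Au) = incWord-absorbs u-word i∈J
  in dA , Ad , uA , Au
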